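{- Let $D$ be a bipartite simple digraph with bipartition $(V_1,V_2)$, $n_1=|V_1|$, $n_2=|V_2|$. If every $v\in V_1$ has out-degree $n_2$ and $k=\sum_{v\in V_2}{\rm deg}_{\rm out}(v)$, then \[ \chi_{A(D)}(\lambda) = \frac{(n_1+n_2)\lambda + k + n_1n_2}{\lambda^2 - k}. \]
   Context: A digraph is bipartite if its underlying graph is bipartite (every arc joins $V_1$ and $V_2$). $A(D)$ is the adjacency matrix of $D$. For a real $n\times n$ matrix $M$ regarded over $\mathbb{C}(\lambda)$, the $M$-coronal is $\chi_M(\lambda)=\mathbf{1}_n^T(\lambda I_n-M)^{ -1}\mathbf{1}_n$, $\mathbf{1}_n$ the all-ones column vector. -}

module Defs where

open import Level using (Level)
open import Data.Nat as ℕ using (ℕ; zero; suc)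
open import Data.Fin using (Fin; zero; suc; _≟_)
open import Data.Bool using (Bool; true; false; if_then_else_; not)
open import Data.Product using (_×_)
open import Relation.Nullary using (¬_; does)
open import Relation.Binary.PropositionalEquality using (_≡_)
open import Algebra.Bundles using (CommutativeRing)

sumℕ : ∀ {n} → (Fin n → ℕ) → ℕ
sumℕ {zero}  f = 0
sumℕ {suc n} f = f zero ℕ.+ sumℕ (λ i → f (suc i))

count : ∀ {n} → (Fin n → Bool) → ℕ
count p = sumℕ (λ i → if p i then 1 else 0)

-- A simple digraph on vertex set Fin n: an arc relation given by a
-- Boolean (so no multiple arcs) with no loops.
record SimpleDigraph (n : ℕ) : Set where
  field
    arc      : Fin n → Fin n → Bool
    loopless : ∀ v → arc v v ≡ false

open SimpleDigraph public

outdeg : ∀ {n} → SimpleDigraph n → Fin n → ℕ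
outdeg D v = count (arc D v)

-- A bipartition (V₁, V₂) of Fin n is given by the indicator inV₁ of V₁
-- (V₂ is its complement).  It is a bipartition of D when every arc
-- joins V₁ and V₂.
IsBipartition : ∀ {n} → SimpleDigraph n → (Fin n → Bool) → Set
IsBipartition D inV₁ = ∀ u v → arc D u v ≡ true → ¬ (inV₁ u ≡ inV₁ v)

size₁ : ∀ {n} → (Fin n → Bool) → ℕ
size₁ inV₁ = count inV₁

size₂ : ∀ {n} → (Fin n → Bool) → ℕ
size₂ inV₁ = count (λ v → not (inV₁ v))

outdegSum₂ : ∀ {n} → SimpleDigraph n → (Fin n → Bool) → ℕ
outdegSum₂ D inV₁ = sumℕ (λ v → if inV₁ v then 0 else outdeg D v)

module Matrices {c ℓ : Level} (R : CommutativeRing c ℓ) where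
  open CommutativeRing R hiding (zero)

  Matrix : ℕ → Set c
  Matrix n = Fin n → Fin n → Carrier

  Σ : ∀ {n} → (Fin n → Carrier) → Carrier
  Σ {zero}  f = 0#
  Σ {suc n} f = f zero + Σ (λ i → f (suc i))

  fromℕ : ℕ → Carrier
  fromℕ zero    = 0#
  fromℕ (suc m) = 1# + fromℕ m

  identity : ∀ {n} → Matrix n
  identity i j = if does (i ≟ j) then 1# else 0#

  _⊗_ : ∀ {n} → Matrix n → Matrix n → Matrix n
  (M ⊗ N) i j = Σ (λ l → M i l * N l j)

  charMatrix : ∀ {n} → Carrier → Matrix n → Matrix n
  charMatrix λ' M i j = λ' * identity i j - M i j

  IsInverse : ∀ {n} → Matrix n → Matrix n → Set ℓ
  IsInverse N M = ∀ i j → ((N ⊗ M) i j ≈ identity i j) × ((M ⊗ N) i j ≈ identity i j)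

  allOnesForm : ∀ {n} → Matrix n → Carrier
  allOnesForm N = Σ (λ i → Σ (λ j → N i j))

  adjacency : ∀ {n} → SimpleDigraph n → Matrix n
  adjacency D i j = if arc D i j then 1# else 0#

-- Let N = (λI − A)⁻¹ and put a = 𝟏ᵀN𝟏_{V₁}, b = 𝟏ᵀN𝟏_{V₂}, c = 𝟏ᵀNd, where d is the
-- out-degree vector supported on V₂; then 𝟏ᵀN𝟏 = a + b.  The degree hypothesis makes every
-- vertex of V₁ point to all of V₂, so A𝟏_{V₁} = d and Aw = (𝟏ᵀw)𝟏_{V₁} for every w supported
-- on V₂.  Applying 𝟏ᵀN(λI − A) = 𝟏ᵀ to 𝟏_{V₁}, d and 𝟏_{V₂} gives λa = n₁ + c, λc = k(1 + a)
-- and λb = n₂(1 + a), whence a = q(λn₁ + k) with q = (λ² − k)⁻¹.  Over an arbitrary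
-- commutative ring the last equation only determines b when λ is a unit.  Reading
-- (λI − A)N = I at a zero row of A, or at two equal rows of A (two vertices of V₁), exhibits
-- an inverse of λ; if neither exists then |V₁| ≤ 1 and every vertex of V₂ has out-degree 1,
-- so d = 𝟏_{V₂}, c = b, k = n₂, and b is read off from λa = n₁ + b.

module Submission where

open import Defs
open import Level using (Level)
open import Data.Nat using (ℕ)
open import Data.Fin using (Fin)
open import Data.Bool using (Bool; true)
open import Relation.Binary.PropositionalEquality using (_≡_)
open import Algebra.Bundles using (CommutativeRing)

open import Data.Nat as ℕ using (zero; suc; _≤_; _<_; z≤n; s≤s)
open import Data.Nat.Properties
  using (≤-refl; ≤-reflexive; <⇒≢; ≤-trans; ≤-antisym; +-mono-≤; +-mono-≤-<; m+n≡0⇒n≡0; n≢0⇒n>0)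
open import Data.Fin using (zero; suc; _≟_)
open import Data.Fin.Properties using (suc-injective; any?)
open import Data.Bool using (false; not; if_then_else_)
open import Data.Bool.Properties using (¬-not; not-injective)
open import Data.Product using (∃; ∃₂; ∃-syntax; _×_; _,_; proj₁; proj₂)
open import Data.Sum using (_⊎_; inj₁; inj₂)
open import Data.Vec.Functional using (Vector)
open import Function using (_∘_; _∘₂_)
open import Relation.Nullary using (yes; no; contradiction)
import Relation.Binary.PropositionalEquality as ≡
open ≡ using (_≢_)

_⊆_ : ∀ {n} → (Fin n → Bool) → (Fin n → Bool) → Set
p ⊆ q = ∀ {i} → p i ≡ true → q i ≡ true

indicator-mono : ∀ {b c} → (b ≡ true → c ≡ true) → (if b then 1 else 0) ≤ (if c then 1 else 0)
indicator-mono {false}         _   = z≤n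
indicator-mono {true} {true}   _   = ≤-refl
indicator-mono {true} {false} b⇒c = contradiction (b⇒c ≡.refl) λ ()

count-mono : ∀ {n} {p q : Fin n → Bool} → p ⊆ q → count p ≤ count q
count-mono {zero}          _   = z≤n
count-mono {suc n} {p} {q} p⊆q = +-mono-≤ (indicator-mono p⊆q) (count-mono {p = p ∘ suc} {q ∘ suc} p⊆q)

count-< : ∀ {n} {p q : Fin n → Bool} {i} → p ⊆ q → q i ≡ true → p i ≡ false → count p < count q
count-< {suc n} {p} {q} {zero} p⊆q qi pi rewrite qi | pi = s≤s (count-mono {p = p ∘ suc} {q ∘ suc} p⊆q)
count-< {suc n} {p} {q} {suc i} p⊆q qi pi =
  +-mono-≤-< (indicator-mono p⊆q) (count-< {p = p ∘ suc} {q ∘ suc} p⊆q qi pi)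

count≡0⇒false : ∀ {n} {p : Fin n → Bool} → count p ≡ 0 → ∀ i → p i ≡ false
count≡0⇒false {suc n} {p} c≡0 zero with p zero | c≡0
... | false | _  = ≡.refl
... | true  | ()
count≡0⇒false {suc n} {p} c≡0 (suc i) = count≡0⇒false (m+n≡0⇒n≡0 (if p zero then 1 else 0) c≡0) i

count≡0⊎witness : ∀ {n} (p : Fin n → Bool) → count p ≡ 0 ⊎ ∃ λ i → p i ≡ true
count≡0⊎witness {zero}  p = inj₁ ≡.refl
count≡0⊎witness {suc n} p with p zero in p₀ | count≡0⊎witness (p ∘ suc)
... | true  | _              = inj₂ (zero , p₀)
... | false | inj₁ c≡0       = inj₁ c≡0
... | false | inj₂ (i , pi) = inj₂ (suc i , pi)

count≤1⊎distinctPair : ∀ {n} (p : Fin n → Bool) →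
                       count p ≤ 1 ⊎ ∃₂ λ x y → x ≢ y × p x ≡ true × p y ≡ true
count≤1⊎distinctPair {zero}  p = inj₁ z≤n
count≤1⊎distinctPair {suc n} p with count≤1⊎distinctPair (p ∘ suc)
... | inj₂ (x , y , x≢y , px , py) = inj₂ (suc x , suc y , x≢y ∘ suc-injective , px , py)
... | inj₁ c≤1 with p zero in p₀ | count≡0⊎witness (p ∘ suc)
...   | false | _             = inj₁ c≤1
...   | true  | inj₁ c≡0      = inj₁ (≤-reflexive (≡.cong suc c≡0))
...   | true  | inj₂ (y , py) = inj₂ (zero , suc y , (λ ()) , p₀ , py)

module Resolvent {c ℓ : Level} (R : CommutativeRing c ℓ) where
  open CommutativeRing R hiding (zero)
  open Matrices R
  open import Algebra.Properties.Semiring.Sum semiring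
    using (sum; sum-cong-≋; ∑-distrib-+; ∑-comm; *-distribˡ-sum; *-distribʳ-sum; sum-replicate-zero)
  open import Algebra.Properties.CommutativeSemigroup *-commutativeSemigroup using (x∙yz≈y∙xz)
  open import Algebra.Properties.Group +-group using (//-rightDividesˡ; //-rightDividesʳ)
  open import Algebra.Properties.Ring ring using ([y-z]x≈yx-zx)
  open import Relation.Binary.Reasoning.Setoid setoid

  𝟙 : Bool → Carrier
  𝟙 b = if b then 1# else 0#

  fromℕ-+ : ∀ m n → fromℕ (m ℕ.+ n) ≈ fromℕ m + fromℕ n
  fromℕ-+ zero    n = sym (+-identityˡ _)
  fromℕ-+ (suc m) n = trans (+-congˡ (fromℕ-+ m n)) (sym (+-assoc _ _ _))

  fromℕ-sumℕ : ∀ {n} (f : Fin n → ℕ) → fromℕ (sumℕ f) ≈ sum (fromℕ ∘ f)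
  fromℕ-sumℕ {zero}  f = refl
  fromℕ-sumℕ {suc n} f = trans (fromℕ-+ (f zero) _) (+-congˡ (fromℕ-sumℕ (f ∘ suc)))

  sum-𝟙 : ∀ {n} (p : Fin n → Bool) → sum (𝟙 ∘ p) ≈ fromℕ (count p)
  sum-𝟙 p = sym (trans (fromℕ-sumℕ λ i → if p i then 1 else 0) (sum-cong-≋ (fromℕ-indicator ∘ p)))
    where
    fromℕ-indicator : ∀ b → fromℕ (if b then 1 else 0) ≈ 𝟙 b
    fromℕ-indicator true  = +-identityʳ 1#
    fromℕ-indicator false = refl

  𝟙-*-vanishing : ∀ {b x} → (b ≡ true → x ≈ 0#) → 𝟙 b * x ≈ 0#
  𝟙-*-vanishing {false} {x} _   = zeroˡ x
  𝟙-*-vanishing {true}  {x} x≈0 = trans (*-identityˡ x) (x≈0 ≡.refl)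

  𝟙-*-supported : ∀ {b x} → (b ≡ false → x ≈ 0#) → 𝟙 b * x ≈ x
  𝟙-*-supported {true}  {x} _   = *-identityˡ x
  𝟙-*-supported {false} {x} x≈0 = trans (zeroˡ x) (sym (x≈0 ≡.refl))

  𝟙-*-𝟙-⊆ : ∀ {a b} → (a ≡ true → b ≡ true) → 𝟙 a * 𝟙 b ≈ 𝟙 a
  𝟙-*-𝟙-⊆ {false} {b}     _   = zeroˡ (𝟙 b)
  𝟙-*-𝟙-⊆ {true} {true}   _   = *-identityʳ 1#
  𝟙-*-𝟙-⊆ {true} {false} a⇒b = contradiction (a⇒b ≡.refl) λ ()

  Σ≡sum : ∀ {n} (f : Fin n → Carrier) → Σ f ≡ sum f
  Σ≡sum {zero}  f = ≡.refl
  Σ≡sum {suc n} f = ≡.cong (f zero +_) (Σ≡sum (f ∘ suc))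

  sum-zero : ∀ {n} {f : Fin n → Carrier} → (∀ i → f i ≈ 0#) → sum f ≈ 0#
  sum-zero {n} f≈0 = trans (sum-cong-≋ f≈0) (sum-replicate-zero n)

  identity-diag : ∀ {n} (i : Fin n) → identity i i ≈ 1#
  identity-diag i with i ≟ i
  ... | yes _   = refl
  ... | no  i≢i = contradiction ≡.refl i≢i

  identity-≢ : ∀ {n} {i j : Fin n} → i ≢ j → identity i j ≈ 0#
  identity-≢ {i = i} {j} i≢j with i ≟ j
  ... | yes i≡j = contradiction i≡j i≢j
  ... | no  _   = refl

  infixr 7 _·_
  _·_ : ∀ {n} → Matrix n → Vector Carrier n → Vector Carrier n
  (M · v) i = sum λ j → M i j * v j

  ·-cong : ∀ {n} (M : Matrix n) {u v : Vector Carrier n} → (∀ j → u j ≈ v j) → ∀ i → (M · u) i ≈ (M · v) i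
  ·-cong M u≈v i = sum-cong-≋ λ j → *-congˡ (u≈v j)

  ·-distrib-+ : ∀ {n} (M : Matrix n) (u v : Vector Carrier n) i →
                (M · λ j → u j + v j) i ≈ (M · u) i + (M · v) i
  ·-distrib-+ M u v i = trans (sum-cong-≋ λ j → distribˡ (M i j) (u j) (v j))
                              (∑-distrib-+ (λ j → M i j * u j) (λ j → M i j * v j))

  ·-*ˡ : ∀ {n} (M : Matrix n) x (v : Vector Carrier n) i → (M · λ j → x * v j) i ≈ x * (M · v) i
  ·-*ˡ M x v i = trans (sum-cong-≋ λ j → x∙yz≈y∙xz (M i j) x (v j)) (sym (*-distribˡ-sum x λ j → M i j * v j))

  identity-· : ∀ {n} (v : Vector Carrier n) i → (identity · v) i ≈ v i
  identity-· {suc n} v zero = begin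
    1# * v zero + sum (λ j → 0# * v (suc j)) ≈⟨ +-cong (*-identityˡ _) (sum-zero λ j → zeroˡ (v (suc j))) ⟩
    v zero + 0#                              ≈⟨ +-identityʳ _ ⟩
    v zero                                   ∎
  identity-· {suc n} v (suc i) = trans (+-cong (zeroˡ (v zero)) (identity-· (v ∘ suc) i)) (+-identityˡ _)

  ·-assoc : ∀ {n} (N M : Matrix n) (v : Vector Carrier n) i → (N · M · v) i ≈ ((N ⊗ M) · v) i
  ·-assoc {n} N M v i = begin
    sum (λ j → N i j * sum λ l → M j l * v l)
      ≈⟨ sum-cong-≋ (λ j → *-distribˡ-sum (N i j) λ l → M j l * v l) ⟩
    sum (λ j → sum λ l → N i j * (M j l * v l))
      ≈⟨ ∑-comm (λ j l → N i j * (M j l * v l)) ⟩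
    sum (λ l → sum λ j → N i j * (M j l * v l))
      ≈⟨ sum-cong-≋ {n} (λ l → sum-cong-≋ {n} λ j → sym (*-assoc _ _ _)) ⟩
    sum (λ l → sum λ j → N i j * M j l * v l)
      ≈⟨ sum-cong-≋ (λ l → sym (*-distribʳ-sum (v l) λ j → N i j * M j l)) ⟩
    sum (λ l → sum (λ j → N i j * M j l) * v l)
      ≈⟨ sum-cong-≋ (λ l → *-congʳ (reflexive (≡.sym (Σ≡sum λ j → N i j * M j l)))) ⟩
    ((N ⊗ M) · v) i ∎

  IsLeftInverse IsRightInverse : ∀ {n} → Matrix n → Matrix n → Set ℓ
  IsLeftInverse  N M = ∀ i j → (N ⊗ M) i j ≈ identity i j
  IsRightInverse N M = ∀ i j → (M ⊗ N) i j ≈ identity i j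

  module _ {n} (λ' : Carrier) (A : Matrix n) where

    charMatrix-·-+ : ∀ (v : Vector Carrier n) i → (charMatrix λ' A · v) i + (A · v) i ≈ λ' * v i
    charMatrix-·-+ v i = begin
      (charMatrix λ' A · v) i + (A · v) i
        ≈⟨ ∑-distrib-+ (λ j → charMatrix λ' A i j * v j) (λ j → A i j * v j) ⟨
      sum (λ j → (λ' * identity i j - A i j) * v j + A i j * v j)
        ≈⟨ sum-cong-≋ {n} (λ j → trans (sym (distribʳ (v j) _ (A i j))) (*-congʳ (//-rightDividesˡ (A i j) _))) ⟩
      sum (λ j → λ' * identity i j * v j)
        ≈⟨ sum-cong-≋ {n} (λ j → *-assoc λ' (identity i j) (v j)) ⟩
      sum (λ j → λ' * (identity i j * v j))
        ≈⟨ *-distribˡ-sum λ' (λ j → identity i j * v j) ⟨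
      λ' * (identity · v) i
        ≈⟨ *-congˡ (identity-· v i) ⟩
      λ' * v i ∎

    resolvent-leftInverse : ∀ {N} → IsLeftInverse N (charMatrix λ' A) →
                            ∀ v i → v i + (N · A · v) i ≈ λ' * (N · v) i
    resolvent-leftInverse {N} inv v i = begin
      v i + (N · A · v) i                               ≈⟨ +-congʳ (sym N·M·v≈v) ⟩
      (N · charMatrix λ' A · v) i + (N · A · v) i       ≈⟨ ·-distrib-+ N _ _ i ⟨
      (N · λ j → (charMatrix λ' A · v) j + (A · v) j) i ≈⟨ ·-cong N (charMatrix-·-+ v) i ⟩
      (N · λ j → λ' * v j) i                            ≈⟨ ·-*ˡ N λ' v i ⟩
      λ' * (N · v) i                                    ∎
      where
      N·M·v≈v : (N · charMatrix λ' A · v) i ≈ v i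
      N·M·v≈v = trans (·-assoc N (charMatrix λ' A) v i)
                  (trans (sum-cong-≋ {n} λ j → *-congʳ (inv i j)) (identity-· v i))

    resolvent-rightInverse : ∀ {N} → IsRightInverse N (charMatrix λ' A) →
                             ∀ i j → λ' * N i j ≈ identity i j + (A · λ l → N l j) i
    resolvent-rightInverse {N} inv i j = begin
      λ' * N i j                                              ≈⟨ charMatrix-·-+ (λ l → N l j) i ⟨
      (charMatrix λ' A · λ l → N l j) i + (A · λ l → N l j) i ≈⟨ +-congʳ M·N≈I ⟩
      identity i j + (A · λ l → N l j) i                      ∎
      where
      M·N≈I : (charMatrix λ' A · λ l → N l j) i ≈ identity i j
      M·N≈I = trans (reflexive (≡.sym (Σ≡sum λ l → charMatrix λ' A i l * N l j))) (inv i j)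

    zeroRow⇒unit : ∀ {N} → IsRightInverse N (charMatrix λ' A) →
                   ∀ x → (∀ t → A x t ≈ 0#) → ∃[ μ ] μ * λ' ≈ 1#
    zeroRow⇒unit {N} inv x row≈0 = N x x , (begin
      N x x * λ'                         ≈⟨ *-comm (N x x) λ' ⟩
      λ' * N x x                         ≈⟨ resolvent-rightInverse inv x x ⟩
      identity x x + (A · λ l → N l x) x ≈⟨ +-cong (identity-diag x) A·Nₓ≈0 ⟩
      1# + 0#                            ≈⟨ +-identityʳ 1# ⟩
      1#                                 ∎)
      where
      A·Nₓ≈0 : (A · λ l → N l x) x ≈ 0#
      A·Nₓ≈0 = sum-zero λ t → trans (*-congʳ (row≈0 t)) (zeroˡ (N t x))

    equalRows⇒unit : ∀ {N} → IsRightInverse N (charMatrix λ' A) →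
                     ∀ {x y} → x ≢ y → (∀ t → A x t ≈ A y t) → ∃[ μ ] μ * λ' ≈ 1#
    equalRows⇒unit {N} inv {x} {y} x≢y rows≈ = N x x - N y x , (begin
      (N x x - N y x) * λ'
        ≈⟨ [y-z]x≈yx-zx λ' (N x x) (N y x) ⟩
      N x x * λ' - N y x * λ'
        ≈⟨ +-cong (*-comm _ λ') (-‿cong (*-comm _ λ')) ⟩
      λ' * N x x - λ' * N y x
        ≈⟨ +-cong (resolvent-rightInverse inv x x) (-‿cong (resolvent-rightInverse inv y x)) ⟩
      identity x x + S - (identity y x + Sʸ)
        ≈⟨ +-cong (+-congʳ (identity-diag x)) (-‿cong 0+Sʸ≈S) ⟩
      1# + S - S
        ≈⟨ //-rightDividesʳ S 1# ⟩
      1# ∎)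
      where
      S Sʸ : Carrier
      S  = (A · λ l → N l x) x
      Sʸ = (A · λ l → N l x) y
      0+Sʸ≈S : identity y x + Sʸ ≈ S
      0+Sʸ≈S = trans (+-cong (identity-≢ (x≢y ∘ ≡.sym)) (sum-cong-≋ {n} λ t → *-congʳ (sym (rows≈ t))))
                     (+-identityˡ S)

module CoronalAlgebra {c ℓ : Level} (R : CommutativeRing c ℓ) where
  open CommutativeRing R
  open import Algebra.Properties.Group +-group using (//-rightDividesˡ)
  open import Algebra.Properties.Ring ring using (+-cancelʳ)
  open import Algebra.Solver.Ring.NaturalCoefficients.Default commutativeSemiring
    using (solve; _:=_; con; _:+_; _:*_)
  open import Relation.Binary.Reasoning.Setoid setoid

  unit-cancelˡ : ∀ {μ x y z} → μ * x ≈ 1# → x * y ≈ x * z → y ≈ z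
  unit-cancelˡ {μ} {x} {y} {z} μx≈1 xy≈xz = begin
    y            ≈⟨ *-identityˡ y ⟨
    1# * y       ≈⟨ *-congʳ μx≈1 ⟨
    μ * x * y    ≈⟨ *-assoc μ x y ⟩
    μ * (x * y)  ≈⟨ *-congˡ xy≈xz ⟩
    μ * (x * z)  ≈⟨ *-assoc μ x z ⟨
    μ * x * z    ≈⟨ *-congʳ μx≈1 ⟩
    1# * z       ≈⟨ *-identityˡ z ⟩
    z            ∎

  module _ {λ' q k : Carrier} (q-inverse : q * (λ' * λ' - k) ≈ 1#) where

    q*λ²≈1+q*k : q * (λ' * λ') ≈ 1# + q * k
    q*λ²≈1+q*k = begin
      q * (λ' * λ')             ≈⟨ *-congˡ (//-rightDividesˡ k (λ' * λ')) ⟨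
      q * (λ' * λ' - k + k)     ≈⟨ distribˡ q (λ' * λ' - k) k ⟩
      q * (λ' * λ' - k) + q * k ≈⟨ +-congʳ q-inverse ⟩
      1# + q * k                ∎

    a-solution : ∀ {n₁ a c} → λ' * a ≈ n₁ + c → λ' * c ≈ k + k * a → a ≈ q * (λ' * n₁ + k)
    a-solution {n₁} {a} {c} λa λc = +-cancelʳ (q * k * a) a (q * (λ' * n₁ + k)) (begin
      a + q * k * a
        ≈⟨ solve 3 (λ a q k → a :+ q :* k :* a := (con 1 :+ q :* k) :* a) refl a q k ⟩
      (1# + q * k) * a
        ≈⟨ *-congʳ q*λ²≈1+q*k ⟨
      q * (λ' * λ') * a
        ≈⟨ solve 3 (λ a q λ' → q :* (λ' :* λ') :* a := q :* (λ' :* (λ' :* a))) refl a q λ' ⟩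
      q * (λ' * (λ' * a))
        ≈⟨ *-congˡ (*-congˡ λa) ⟩
      q * (λ' * (n₁ + c))
        ≈⟨ solve 4 (λ q λ' n₁ c → q :* (λ' :* (n₁ :+ c)) := q :* (λ' :* n₁) :+ q :* (λ' :* c)) refl q λ' n₁ c ⟩
      q * (λ' * n₁) + q * (λ' * c)
        ≈⟨ +-congˡ (*-congˡ λc) ⟩
      q * (λ' * n₁) + q * (k + k * a)
        ≈⟨ solve 5 (λ q λ' n₁ k a → q :* (λ' :* n₁) :+ q :* (k :+ k :* a) := q :* (λ' :* n₁ :+ k) :+ q :* k :* a) refl q λ' n₁ k a ⟩
      q * (λ' * n₁ + k) + q * k * a ∎)

    module _ {n₁ n₂ a : Carrier} (a≈ : a ≈ q * (λ' * n₁ + k)) where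

      λ*b-solution : λ' * (q * n₂ * (λ' + n₁)) ≈ n₂ + n₂ * a
      λ*b-solution = begin
        λ' * (q * n₂ * (λ' + n₁))
          ≈⟨ solve 4 (λ λ' q n₂ n₁ → λ' :* (q :* n₂ :* (λ' :+ n₁)) := n₂ :* (q :* (λ' :* λ')) :+ n₂ :* (q :* (λ' :* n₁))) refl λ' q n₂ n₁ ⟩
        n₂ * (q * (λ' * λ')) + n₂ * (q * (λ' * n₁))
          ≈⟨ +-congʳ (*-congˡ q*λ²≈1+q*k) ⟩
        n₂ * (1# + q * k) + n₂ * (q * (λ' * n₁))
          ≈⟨ solve 5 (λ λ' q n₂ n₁ k → n₂ :* (con 1 :+ q :* k) :+ n₂ :* (q :* (λ' :* n₁)) := n₂ :+ n₂ :* (q :* (λ' :* n₁ :+ k))) refl λ' q n₂ n₁ k ⟩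
        n₂ + n₂ * (q * (λ' * n₁ + k))
          ≈⟨ +-congˡ (*-congˡ a≈) ⟨
        n₂ + n₂ * a ∎

      k≈n₂⇒b-solution : ∀ {b} → b + n₁ ≈ λ' * a → k ≈ n₂ → b ≈ q * n₂ * (λ' + n₁)
      k≈n₂⇒b-solution {b} b+n₁≈λa k≈n₂ = +-cancelʳ n₁ b (q * n₂ * (λ' + n₁)) (begin
        b + n₁
          ≈⟨ b+n₁≈λa ⟩
        λ' * a
          ≈⟨ *-congˡ a≈ ⟩
        λ' * (q * (λ' * n₁ + k))
          ≈⟨ solve 4 (λ λ' q n₁ k → λ' :* (q :* (λ' :* n₁ :+ k)) := q :* (λ' :* λ') :* n₁ :+ q :* k :* λ') refl λ' q n₁ k ⟩
        q * (λ' * λ') * n₁ + q * k * λ'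
          ≈⟨ +-congʳ (*-congʳ q*λ²≈1+q*k) ⟩
        (1# + q * k) * n₁ + q * k * λ'
          ≈⟨ solve 4 (λ λ' q n₁ k → (con 1 :+ q :* k) :* n₁ :+ q :* k :* λ' := q :* k :* (λ' :+ n₁) :+ n₁) refl λ' q n₁ k ⟩
        q * k * (λ' + n₁) + n₁
          ≈⟨ +-congʳ (*-congʳ (*-congˡ k≈n₂)) ⟩
        q * n₂ * (λ' + n₁) + n₁ ∎)

      a+b≈coronal : ∀ {b} → b ≈ q * n₂ * (λ' + n₁) → a + b ≈ ((n₁ + n₂) * λ' + k + n₁ * n₂) * q
      a+b≈coronal {b} b≈ = begin
        a + b
          ≈⟨ +-cong a≈ b≈ ⟩
        q * (λ' * n₁ + k) + q * n₂ * (λ' + n₁)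
          ≈⟨ solve 5 (λ λ' q n₁ n₂ k → q :* (λ' :* n₁ :+ k) :+ q :* n₂ :* (λ' :+ n₁) := ((n₁ :+ n₂) :* λ' :+ k :+ n₁ :* n₂) :* q) refl λ' q n₁ n₂ k ⟩
        ((n₁ + n₂) * λ' + k + n₁ * n₂) * q ∎

module CompleteFromV₁ {n} (D : SimpleDigraph n) (inV₁ : Fin n → Bool) (bip : IsBipartition D inV₁)
                      (deg : ∀ v → inV₁ v ≡ true → outdeg D v ≡ size₂ inV₁) where

  arc-from-V₂ : ∀ {u v} → inV₁ u ≡ false → arc D u v ≡ true → inV₁ v ≡ true
  arc-from-V₂ {u} {v} u∈V₂ uv = ≡.trans (¬-not (bip u v uv ∘ ≡.sym)) (≡.cong not u∈V₂)

  arc-from-V₁ : ∀ {u} → inV₁ u ≡ true → ∀ v → arc D u v ≡ not (inV₁ v)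
  arc-from-V₁ {u} u∈V₁ v with inV₁ v in v∈ | arc D u v in uv
  ... | true  | false = ≡.refl
  ... | true  | true  = contradiction (≡.trans u∈V₁ (≡.sym v∈)) (bip u v uv)
  ... | false | true  = ≡.refl
  ... | false | false = contradiction (deg u u∈V₁) (<⇒≢ (count-< {i = v} arcs⊆V₂ (≡.cong not v∈) uv))
    where
    arcs⊆V₂ : arc D u ⊆ (not ∘ inV₁)
    arcs⊆V₂ {t} ut = ≡.trans (≡.sym (¬-not (bip u t ut))) u∈V₁

module BipartiteResolvent {c ℓ : Level} (R : CommutativeRing c ℓ)
  {n} (D : SimpleDigraph n) (inV₁ : Fin n → Bool) (bip : IsBipartition D inV₁)
  (deg : ∀ v → inV₁ v ≡ true → outdeg D v ≡ size₂ inV₁) where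

  open CommutativeRing R hiding (zero)
  open Matrices R
  open Resolvent R
  open CompleteFromV₁ D inV₁ bip deg
  open import Algebra.Properties.Semiring.Sum semiring using (sum; sum-cong-≋; ∑-distrib-+; *-distribˡ-sum)
  open import Relation.Binary.Reasoning.Setoid setoid

  A : Matrix n
  A = adjacency D

  e₁ e₂ d₂ : Vector Carrier n
  e₁ = 𝟙 ∘ inV₁
  e₂ = 𝟙 ∘ not ∘ inV₁
  d₂ v = fromℕ (if inV₁ v then 0 else outdeg D v)

  n₁ n₂ k : Carrier
  n₁ = fromℕ (size₁ inV₁)
  n₂ = fromℕ (size₂ inV₁)
  k  = fromℕ (outdegSum₂ D inV₁)

  sum-e₂≈n₂ : sum e₂ ≈ n₂
  sum-e₂≈n₂ = sum-𝟙 (not ∘ inV₁)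

  sum-d₂≈k : sum d₂ ≈ k
  sum-d₂≈k = sym (fromℕ-sumℕ λ v → if inV₁ v then 0 else outdeg D v)

  VanishesOnV₁ : Vector Carrier n → Set ℓ
  VanishesOnV₁ w = ∀ {t} → inV₁ t ≡ true → w t ≈ 0#

  A·e₁≈d₂ : ∀ j → (A · e₁) j ≈ d₂ j
  A·e₁≈d₂ j with inV₁ j in j∈
  ... | true  = sum-zero λ t → trans (*-congʳ (reflexive (≡.cong 𝟙 (arc-from-V₁ j∈ t))))
                                      (𝟙-*-vanishing (reflexive ∘ ≡.cong 𝟙 ∘ not-injective))
  ... | false = trans (sum-cong-≋ {n} λ t → 𝟙-*-𝟙-⊆ (arc-from-V₂ j∈)) (sum-𝟙 (arc D j))

  A·w≈sum*e₁ : ∀ {w} → VanishesOnV₁ w → ∀ j → (A · w) j ≈ sum w * e₁ j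
  A·w≈sum*e₁ {w} w∈ j with inV₁ j in j∈
  ... | true  = trans (sum-cong-≋ {n} λ t → trans (*-congʳ (reflexive (≡.cong 𝟙 (arc-from-V₁ j∈ t))))
                                                   (𝟙-*-supported (w∈ ∘ not-injective)))
                      (sym (*-identityʳ (sum w)))
  ... | false = trans (sum-zero {n} λ t → 𝟙-*-vanishing (w∈ ∘ arc-from-V₂ j∈)) (sym (zeroʳ (sum w)))

  e₂-vanishesOnV₁ : VanishesOnV₁ e₂
  e₂-vanishesOnV₁ t∈V₁ = reflexive (≡.cong (𝟙 ∘ not) t∈V₁)

  d₂-vanishesOnV₁ : VanishesOnV₁ d₂
  d₂-vanishesOnV₁ {t} t∈V₁ = reflexive (≡.cong (λ b → fromℕ (if b then 0 else outdeg D t)) t∈V₁)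

  module OnesForm (λ' : Carrier) {N : Matrix n} (inv : IsInverse N (charMatrix λ' A)) where

    𝟏ᵀN : Vector Carrier n → Carrier
    𝟏ᵀN u = sum (N · u)

    𝟏ᵀN-cong : ∀ {u v} → (∀ j → u j ≈ v j) → 𝟏ᵀN u ≈ 𝟏ᵀN v
    𝟏ᵀN-cong u≈v = sum-cong-≋ {n} (·-cong N u≈v)

    𝟏ᵀN-*ˡ : ∀ x v → 𝟏ᵀN (λ j → x * v j) ≈ x * 𝟏ᵀN v
    𝟏ᵀN-*ˡ x v = trans (sum-cong-≋ {n} (·-*ˡ N x v)) (sym (*-distribˡ-sum x (N · v)))

    𝟏ᵀN-+ : ∀ u v → 𝟏ᵀN (λ j → u j + v j) ≈ 𝟏ᵀN u + 𝟏ᵀN v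
    𝟏ᵀN-+ u v = trans (sum-cong-≋ {n} (·-distrib-+ N u v)) (∑-distrib-+ (N · u) (N · v))

    λ*𝟏ᵀN : ∀ v → λ' * 𝟏ᵀN v ≈ sum v + 𝟏ᵀN (A · v)
    λ*𝟏ᵀN v = begin
      λ' * 𝟏ᵀN v                           ≈⟨ *-distribˡ-sum λ' (N · v) ⟩
      sum (λ i → λ' * (N · v) i)           ≈⟨ sum-cong-≋ {n} (resolvent-leftInverse λ' A (proj₁ ∘₂ inv) v) ⟨
      sum (λ i → v i + (N · A · v) i)      ≈⟨ ∑-distrib-+ v (N · A · v) ⟩
      sum v + 𝟏ᵀN (A · v)                  ∎

    λ*𝟏ᵀN-e₁ : λ' * 𝟏ᵀN e₁ ≈ n₁ + 𝟏ᵀN d₂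
    λ*𝟏ᵀN-e₁ = trans (λ*𝟏ᵀN e₁) (+-cong (sum-𝟙 inV₁) (𝟏ᵀN-cong A·e₁≈d₂))

    λ*𝟏ᵀN-vanishing : ∀ {w} → VanishesOnV₁ w → λ' * 𝟏ᵀN w ≈ sum w + sum w * 𝟏ᵀN e₁
    λ*𝟏ᵀN-vanishing {w} w∈ =
      trans (λ*𝟏ᵀN w) (+-congˡ (trans (𝟏ᵀN-cong (A·w≈sum*e₁ w∈)) (𝟏ᵀN-*ˡ (sum w) e₁)))

    λ*𝟏ᵀN-d₂ : λ' * 𝟏ᵀN d₂ ≈ k + k * 𝟏ᵀN e₁
    λ*𝟏ᵀN-d₂ = trans (λ*𝟏ᵀN-vanishing d₂-vanishesOnV₁) (+-cong sum-d₂≈k (*-congʳ sum-d₂≈k))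

    λ*𝟏ᵀN-e₂ : λ' * 𝟏ᵀN e₂ ≈ n₂ + n₂ * 𝟏ᵀN e₁
    λ*𝟏ᵀN-e₂ = trans (λ*𝟏ᵀN-vanishing e₂-vanishesOnV₁) (+-cong sum-e₂≈n₂ (*-congʳ sum-e₂≈n₂))

    allOnesForm≈𝟏ᵀN-e₁+e₂ : allOnesForm N ≈ 𝟏ᵀN e₁ + 𝟏ᵀN e₂
    allOnesForm≈𝟏ᵀN-e₁+e₂ = begin
      allOnesForm N           ≡⟨ Σ≡sum (λ i → Σ (N i)) ⟩
      sum (λ i → Σ (N i))     ≈⟨ sum-cong-≋ {n} (λ i → trans (reflexive (Σ≡sum (N i))) (sum-cong-≋ {n} (split i))) ⟩
      𝟏ᵀN (λ j → e₁ j + e₂ j) ≈⟨ 𝟏ᵀN-+ e₁ e₂ ⟩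
      𝟏ᵀN e₁ + 𝟏ᵀN e₂         ∎
      where
      split : ∀ i j → N i j ≈ N i j * (e₁ j + e₂ j)
      split i j with inV₁ j
      ... | true  = sym (trans (*-congˡ (+-identityʳ 1#)) (*-identityʳ (N i j)))
      ... | false = sym (trans (*-congˡ (+-identityˡ 1#)) (*-identityʳ (N i j)))

    unit⊎d₂≈e₂ : (∃[ μ ] μ * λ' ≈ 1#) ⊎ (∀ j → d₂ j ≈ e₂ j)
    unit⊎d₂≈e₂ with count≤1⊎distinctPair inV₁
    ... | inj₂ (x , y , x≢y , x∈V₁ , y∈V₁) =
      inj₁ (equalRows⇒unit λ' A (proj₂ ∘₂ inv) x≢y λ t →
              reflexive (≡.cong 𝟙 (≡.trans (arc-from-V₁ x∈V₁ t) (≡.sym (arc-from-V₁ y∈V₁ t)))))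
    ... | inj₁ n₁≤1 with any? (λ v → outdeg D v ℕ.≟ 0)
    ...   | yes (v , outdeg≡0) =
      inj₁ (zeroRow⇒unit λ' A (proj₂ ∘₂ inv) v λ t → reflexive (≡.cong 𝟙 (count≡0⇒false outdeg≡0 t)))
    ...   | no noSink = inj₂ d₂≈e₂
      where
      d₂≈e₂ : ∀ j → d₂ j ≈ e₂ j
      d₂≈e₂ j with inV₁ j in j∈
      ... | true  = refl
      ... | false = trans (reflexive (≡.cong fromℕ outdeg≡1)) (+-identityʳ 1#)
        where
        outdeg≡1 : outdeg D j ≡ 1
        outdeg≡1 = ≤-antisym (≤-trans (count-mono {p = arc D j} {inV₁} (arc-from-V₂ j∈)) n₁≤1)
                             (n≢0⇒n>0 (noSink ∘ (j ,_)))

proposition2p9 : ∀ {c ℓ : Level} (R : CommutativeRing c ℓ) →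
    let open CommutativeRing R
        open Matrices R
    in ∀ {n : ℕ} (D : SimpleDigraph n) (inV₁ : Fin n → Bool) →
       IsBipartition D inV₁ →
       (∀ v → inV₁ v ≡ true → outdeg D v ≡ size₂ inV₁) →
       ∀ (λ' : Carrier) (N : Matrix n) → IsInverse N (charMatrix λ' (adjacency D)) →
       ∀ (q : Carrier) → q * (λ' * λ' - fromℕ (outdegSum₂ D inV₁)) ≈ 1# →
       allOnesForm N ≈
         ((fromℕ (size₁ inV₁) + fromℕ (size₂ inV₁)) * λ'
           + fromℕ (outdegSum₂ D inV₁)
           + fromℕ (size₁ inV₁) * fromℕ (size₂ inV₁)) * q
proposition2p9 R D inV₁ bip deg λ' N inv q q-inverse =
  trans allOnesForm≈𝟏ᵀN-e₁+e₂ (a+b≈coronal q-inverse a≈ b≈)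
  where
  open CommutativeRing R
  open Resolvent R
  open CoronalAlgebra R
  open BipartiteResolvent R D inV₁ bip deg
  open OnesForm λ' inv
  open import Algebra.Properties.Semiring.Sum semiring using (sum-cong-≋)

  a≈ : 𝟏ᵀN e₁ ≈ q * (λ' * n₁ + k)
  a≈ = a-solution q-inverse λ*𝟏ᵀN-e₁ λ*𝟏ᵀN-d₂

  b≈ : 𝟏ᵀN e₂ ≈ q * n₂ * (λ' + n₁)
  b≈ with unit⊎d₂≈e₂
  ... | inj₁ (μ , μλ≈1) = unit-cancelˡ μλ≈1 (trans λ*𝟏ᵀN-e₂ (sym (λ*b-solution q-inverse a≈)))
  ... | inj₂ d₂≈e₂      = k≈n₂⇒b-solution q-inverse a≈ b+n₁≈λa k≈n₂
    where
    b+n₁≈λa : 𝟏ᵀN e₂ + n₁ ≈ λ' * 𝟏ᵀN e₁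
    b+n₁≈λa = sym (trans λ*𝟏ᵀN-e₁ (trans (+-congˡ (𝟏ᵀN-cong d₂≈e₂)) (+-comm n₁ _)))
    k≈n₂ : k ≈ n₂
    k≈n₂ = trans (sym sum-d₂≈k) (trans (sum-cong-≋ d₂≈e₂) sum-e₂≈n₂)
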